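{- Let $p$ be an odd prime, $b\in\overline{\mathbb{F}}_p^\times$, let $\mathcal{H}_2$, $M_b$, $1_1,1_2$ and $A$ be as in the context, and fix $i\in\{1,2\}$ with ${}^si$ the other index. Then the chain $$\{0\}\ \subset\ \overline{\mathbb{F}}_p1_i\oplus\overline{\mathbb{F}}_p(U\cdot1_i)\ \subset\ A1_i\oplus A(U\cdot 1_i)=A1_i\oplus A1_{{}^si}$$ $$\subset\ A1_i\oplus A1_{{}^si}\oplus\overline{\mathbb{F}}_p\Big(\tfrac{\eta_1-\eta_2}{2}1_i\Big)\oplus\overline{\mathbb{F}}_p\Big(U\cdot\tfrac{\eta_1-\eta_2}{2}1_i\Big)\ \subset\ M_b$$ is a composition series of the $\mathcal{H}_2$-module $M_b$ with simple subquotients. Here the direct sums are direct sums of $\overline{\mathbb{F}}_p$-vector spaces.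
   Context: Let $k=\overline{\mathbb{F}}_p$, $\Lambda=\mathbb{Z}^2$, $W_0=\{1,s\}$ with $s$ swapping coordinates, and $W=e^\Lambda\rtimes W_0$. Put $$u=e^{(1,0)}s,\qquad s_0=e^{(1,-1)}s.$$ The group $W_{\mathrm{aff}}=e^{\mathbb{Z}(1,-1)}\rtimes W_0$ is Coxeter with generators $s_0,s$; its length is extended to $W=W_{\mathrm{aff}}\rtimes u^{\mathbb{Z}}$ by $\ell(u)=0$. The nil Hecke algebra $\mathcal{H}^{\mathrm{nil}}$ over $k$ has basis $\{T_w\}_{w\in W}$, with $T_wT_{w'}=T_{ww'}$ when lengths add and $T_s^2=T_{s_0}^2=0$. Put $S=T_s$ and $U=T_u$. $W$ acts on $\{1,2\}$ via $W\to W_0$, with $s$ swapping $1,2$. $\mathcal{H}_2=(k\varepsilon_1\times k\varepsilon_2)\otimes_k\mathcal{H}^{\mathrm{nil}}$ with multiplication $$(\varepsilon_i\otimes T_w)(\varepsilon_{i'}\otimes T_{w'})=\varepsilon_i\varepsilon_{{}^wi'}\otimes T_wT_{w'}.$$ Let $P=k[\eta_1,\eta_2]$ with $s$ swapping $\eta_1,\eta_2$, and set $\xi_1=\eta_1+\eta_2$, $\xi_2=\eta_1\eta_2$. Let $D_s(a)=\dfrac{a-s(a)}{\eta_1-\eta_2}$. $\mathscr{A}^{\mathrm{nil}}$ is the ring homomorphism $\mathcal{H}^{\mathrm{nil}}\to\mathrm{End}_{k[\xi_1,\xi_2^{\pm1}]}(P[\xi_2^{ -1}])$ with: - $S\mapsto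 -D_s$; - $U\mapsto$ the operator with matrix $$\begin{pmatrix}\frac{\xi_1^2}{2}-\xi_2 & -\xi_1(\frac{\xi_1^2}{4}-\xi_2)\\ \xi_1 & -(\frac{\xi_1^2}{2}-\xi_2)\end{pmatrix}$$ in the basis $\{1,\frac{\eta_1-\eta_2}{2}\}$ (columns are the images). $\mathcal{H}_2$ acts on $P[\xi_2^{ -1}]\times P[\xi_2^{ -1}]$ via $$\varepsilon_iT_w\mapsto p_i\circ\mathrm{diag}(\mathscr{A}^{\mathrm{nil}}(T_w))\circ\mathrm{perm}(w),$$ where: - $\mathrm{diag}(X)$ applies $X$ in both factors; - $\mathrm{perm}(w)$ swaps the factors if $w$ maps to $s$ and is the identity otherwise; - $p_i$ is the projection onto the $i$-th factor. The elements $\zeta_1=US+SU$ and $\zeta_2=U^2$ act as $-\xi_1$ and $\xi_2^2$, respectively. $M_b$ is the quotient of $P[\xi_2^{ -1}]\times P[\xi_2^{ -1}]$ by the submodule generated by $\xi_1$ and $\xi_2^2-b$. This is the reduction along $\zeta_1\mapsto0$, $\zeta_2\mapsto b$, corresponding to a supersingular central character. It is an $\mathcal{H}_2$-module, and a module over $$A=k[\xi_2]/(\xi_2^2-b),$$ with $A$-basis $\{1_j,\tfrac{\eta_1-\eta_2}{2}1_j\}_{j=1,2}$, where $1_1=(1,0)$ and $1_2=(0,1)$. In particular $\dim_k M_b=8$. -}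

module Defs where

open import Level using (Level; _⊔_; Lift; lift)
open import Algebra.Bundles using (CommutativeRing)
open import Data.Nat using (ℕ; zero; suc)
open import Data.Fin using (Fin; zero; suc)
open import Data.List using (List; []; _∷_; _++_; map)
open import Data.List.Relation.Unary.Any using (Any)
open import Data.Vec using (Vec; []; _∷_; lookup; foldr)
open import Data.Product using (Σ; ∃; _×_; _,_)
open import Data.Unit using (⊤)
open import Relation.Nullary using (¬_)
open import Relation.Binary using (Decidable)

-- The standard library has no fields and no \bar F_p, so we take a
-- commutative ring K and require that it is (up to isomorphism) an
-- algebraic closure of F_p: a field of characteristic p which is
-- algebraically closed and algebraic over its prime field.
-- Decidability of equality (true for \bar F_p) is also recorded.

module _ {c ℓ} (K : CommutativeRing c ℓ) where
  open CommutativeRing K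

  natK : ℕ → Carrier
  natK zero    = 0#
  natK (suc n) = 1# + natK n

  evalPoly : List Carrier → Carrier → Carrier
  evalPoly []       x = 0#
  evalPoly (a ∷ as) x = a + x * evalPoly as x

  record IsAlgClosureOfFp (p : ℕ) : Set (c ⊔ ℓ) where
    field
      decEq      : Decidable _≈_
      nontrivial : ¬ (1# ≈ 0#)
      inverse    : ∀ x → ¬ (x ≈ 0#) → ∃ λ y → x * y ≈ 1#
      charP      : natK p ≈ 0#
      -- every polynomial c₀ + c₁X + ... + aXⁿ with n ≥ 1 and a ≠ 0 has a root
      algClosed  : ∀ (c₀ : Carrier) (cs : List Carrier) (a : Carrier) →
                   ¬ (a ≈ 0#) → ∃ λ x → evalPoly (c₀ ∷ (cs ++ (a ∷ []))) x ≈ 0#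
      -- every element is a root of a nonzero polynomial over the prime field
      algebraic  : ∀ x → ∃ λ (ns : List ℕ) →
                   Any (λ n → ¬ (natK n ≈ 0#)) ns × evalPoly (map natK ns) x ≈ 0#

-- Elements of M_b = (P[ξ₂⁻¹] × P[ξ₂⁻¹]) / (ξ₁, ξ₂² - b):
--   * A  = k[ξ₂]/(ξ₂² - b) has k-basis 1, ξ₂; an element is (a₀ , a₁) = a₀ + a₁ ξ₂;
--   * each factor P[ξ₂⁻¹]/(ξ₁, ξ₂² - b) is free over A with basis 1, δ := (η₁-η₂)/2;
--     an element is (f , g) = f·1 + g·δ   (note δ² = -ξ₂ there, since η₂ = -η₁);
--   * M_b = Comp × Comp, the two factors.
--
-- Operators (computed from the context after reducing mod ξ₁ = 0):
--   -D_s (f·1 + g·δ) = -g·1        (D_s 1 = 0, D_s δ = 1, D_s is A-linear)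
--   A(U) (f·1 + g·δ) = -ξ₂ f·1 + ξ₂ g·δ     (matrix of U with ξ₁ = 0)
--   A(U)⁻¹ = A(T_{u⁻¹}) : f·1 + g·δ ↦ -ξ₂⁻¹ f·1 + ξ₂⁻¹ g·δ ,  ξ₂⁻¹ = b⁻¹ ξ₂ in A.
-- H₂ acts by  ε_i T_w ↦ p_i ∘ diag(A(T_w)) ∘ perm(w).
-- H₂ is spanned over k by the ε_i T_w, and every T_w is a product of
-- T_s = S, U = T_u, U⁻¹ = T_{u⁻¹}  (T_{s₀} = U S U⁻¹ since s₀ = u s u⁻¹),
-- so the H₂-submodules are exactly the k-subspaces stable under
-- ε₁, ε₂, S = (ε₁+ε₂)T_s, U = (ε₁+ε₂)T_u, U⁻¹ = (ε₁+ε₂)T_{u⁻¹}.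

module Mb {c ℓ} (K : CommutativeRing c ℓ) (b b⁻¹ : CommutativeRing.Carrier K) where
  open CommutativeRing K using (Carrier; _≈_; _+_; _*_; -_; 0#; 1#)

  A : Set c
  A = Carrier × Carrier

  _≈A_ : A → A → Set ℓ
  (a₀ , a₁) ≈A (c₀ , c₁) = (a₀ ≈ c₀) × (a₁ ≈ c₁)

  0A 1A : A
  0A = 0# , 0#
  1A = 1# , 0#

  _+A_ : A → A → A
  (a₀ , a₁) +A (c₀ , c₁) = (a₀ + c₀) , (a₁ + c₁)

  -A_ : A → A
  -A (a₀ , a₁) = (- a₀) , (- a₁)

  _*A_ : A → A → A
  (a₀ , a₁) *A (c₀ , c₁) = ((a₀ * c₀) + (b * (a₁ * c₁))) , ((a₀ * c₁) + (a₁ * c₀))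

  ξA ξA⁻¹ : A
  ξA   = 0# , 1#
  ξA⁻¹ = 0# , b⁻¹

  Comp : Set c
  Comp = A × A

  M : Set c
  M = Comp × Comp

  _≈M_ : M → M → Set ℓ
  ((f₁ , g₁) , (f₂ , g₂)) ≈M ((f₁' , g₁') , (f₂' , g₂')) =
    ((f₁ ≈A f₁') × (g₁ ≈A g₁')) × ((f₂ ≈A f₂') × (g₂ ≈A g₂'))

  0C : Comp
  0C = 0A , 0A

  0M : M
  0M = 0C , 0C

  _+M_ : M → M → M
  ((f₁ , g₁) , (f₂ , g₂)) +M ((f₁' , g₁') , (f₂' , g₂')) =
    ((f₁ +A f₁') , (g₁ +A g₁')) , ((f₂ +A f₂') , (g₂ +A g₂'))

  _⋆_ : A → M → M
  a ⋆ ((f₁ , g₁) , (f₂ , g₂)) = ((a *A f₁) , (a *A g₁)) , ((a *A f₂) , (a *A g₂))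

  _•_ : Carrier → M → M
  x • m = (x , 0#) ⋆ m

  negDs : Comp → Comp
  negDs (f , g) = (-A g) , 0A

  opU : Comp → Comp
  opU (f , g) = (-A (ξA *A f)) , (ξA *A g)

  opU⁻¹ : Comp → Comp
  opU⁻¹ (f , g) = (-A (ξA⁻¹ *A f)) , (ξA⁻¹ *A g)

  diag : (Comp → Comp) → M → M
  diag X (x₁ , x₂) = X x₁ , X x₂

  perm : M → M
  perm (x₁ , x₂) = x₂ , x₁

  proj : Fin 2 → M → M
  proj zero       (x₁ , x₂) = x₁ , 0C
  proj (suc zero) (x₁ , x₂) = 0C , x₂

  actε : Fin 2 → M → M
  actε i = proj i

  actS actU actU⁻¹ : M → M
  actS   m = proj zero (diag negDs (perm m)) +M proj (suc zero) (diag negDs (perm m))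
  actU   m = proj zero (diag opU (perm m)) +M proj (suc zero) (diag opU (perm m))
  actU⁻¹ m = proj zero (diag opU⁻¹ (perm m)) +M proj (suc zero) (diag opU⁻¹ (perm m))

  other : Fin 2 → Fin 2
  other zero       = suc zero
  other (suc zero) = zero

  inFactor : Fin 2 → Comp → M
  inFactor zero       x = x , 0C
  inFactor (suc zero) x = 0C , x

  one : Fin 2 → M
  one i = inFactor i (1A , 0A)

  δone : Fin 2 → M
  δone i = inFactor i (0A , 1A)

  L : Level
  L = c ⊔ ℓ

  Sub : Set (Level.suc L)
  Sub = M → Set L

  _⊆_ : Sub → Sub → Set L
  V ⊆ W = ∀ x → V x → W x

  _≐_ : Sub → Sub → Set L
  V ≐ W = (V ⊆ W) × (W ⊆ V)

  ZeroSub : Sub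
  ZeroSub x = Lift L (x ≈M 0M)

  Full : Sub
  Full _ = Lift L ⊤

  kSpan : M → Sub
  kSpan v x = Σ Carrier λ t → x ≈M (t • v)

  ASpan : M → Sub
  ASpan v x = Σ A λ a → x ≈M (a ⋆ v)

  sumM : ∀ {n} → Vec M n → M
  sumM = foldr _ _+M_ 0M

  SumOf : ∀ {n} → Vec Sub n → Sub
  SumOf {n} Ws x = Σ (Vec M n) λ xs →
    (∀ j → lookup Ws j (lookup xs j)) × (x ≈M sumM xs)

  IsDirect : ∀ {n} → Vec Sub n → Set L
  IsDirect {n} Ws = ∀ (xs : Vec M n) → (∀ j → lookup Ws j (lookup xs j)) →
    sumM xs ≈M 0M → ∀ j → lookup xs j ≈M 0M

  record IsSubmodule (V : Sub) : Set L where
    field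
      respects : ∀ {x y} → x ≈M y → V x → V y
      has0     : V 0M
      add      : ∀ {x y} → V x → V y → V (x +M y)
      scale    : ∀ (t : Carrier) {x} → V x → V (t • x)
      closedε  : ∀ (i : Fin 2) {x} → V x → V (actε i x)
      closedS  : ∀ {x} → V x → V (actS x)
      closedU  : ∀ {x} → V x → V (actU x)
      closedU⁻¹ : ∀ {x} → V x → V (actU⁻¹ x)

  -- W/V is a simple H₂-module (V ⊆ W submodules): W/V ≠ 0, and every
  -- submodule X with V ⊆ X ⊆ W and X ≠ V (witnessed by an element of
  -- X outside V) equals W (correspondence theorem; constructive form of
  -- "X = V or X = W").
  SimpleSubquotient : Sub → Sub → Set (Level.suc L)
  SimpleSubquotient V W =
    (V ⊆ W) ×
    (Σ M λ x → W x × ¬ V x) ×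
    (∀ (X : Sub) → IsSubmodule X → V ⊆ X → X ⊆ W →
       (Σ M λ x → X x × ¬ V x) → W ⊆ X)

  lastOf : Sub → List Sub → Sub
  lastOf V []       = V
  lastOf V (W ∷ Ws) = lastOf W Ws

  AllSub : List Sub → Set L
  AllSub []       = Lift L ⊤
  AllSub (V ∷ Vs) = IsSubmodule V × AllSub Vs

  ConsecSimple : Sub → List Sub → Set (Level.suc L)
  ConsecSimple V []       = Lift (Level.suc L) ⊤
  ConsecSimple V (W ∷ Ws) = SimpleSubquotient V W × ConsecSimple W Ws

  IsCompositionSeries : Sub → List Sub → Set (Level.suc L)
  IsCompositionSeries V₀ Vs =
    IsSubmodule V₀ × AllSub Vs × (V₀ ≐ ZeroSub) × (lastOf V₀ Vs ≐ Full) ×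
    ConsecSimple V₀ Vs

  V₁ V₂ V₂' V₃ : Fin 2 → Sub
  V₁ i = SumOf (kSpan (one i) ∷ kSpan (actU (one i)) ∷ [])
  V₂ i = SumOf (ASpan (one i) ∷ ASpan (actU (one i)) ∷ [])
  V₂' i = SumOf (ASpan (one i) ∷ ASpan (one (other i)) ∷ [])
  V₃ i = SumOf (ASpan (one i) ∷ ASpan (one (other i)) ∷
                kSpan (δone i) ∷ kSpan (actU (δone i)) ∷ [])

  Theorem10Claim : Fin 2 → Set (Level.suc L)
  Theorem10Claim i =
    IsDirect (kSpan (one i) ∷ kSpan (actU (one i)) ∷ []) ×
    IsDirect (ASpan (one i) ∷ ASpan (actU (one i)) ∷ []) ×
    IsDirect (ASpan (one i) ∷ ASpan (one (other i)) ∷ []) ×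
    IsDirect (ASpan (one i) ∷ ASpan (one (other i)) ∷
              kSpan (δone i) ∷ kSpan (actU (δone i)) ∷ []) ×
    (V₂ i ≐ V₂' i) ×
    IsCompositionSeries ZeroSub (V₁ i ∷ V₂ i ∷ V₃ i ∷ Full ∷ [])

{-# OPTIONS --safe #-}
-- In the k-basis ξ₂^a δ^e 1_f of M_b (δ = (η₁-η₂)/2), each of ε₁, ε₂, S, U, U⁻¹ acts by a
-- monomial matrix, so the span of a set of basis vectors that is stable under the index maps
-- of S and U is a submodule; every term of the chain is such a span. Each step of the chain
-- adds one U-orbit {e_j, e_Uj}, whose two vectors lie in different factors. If a submodule X
-- lies strictly between two consecutive terms, pick x ∈ X outside the smaller one: removing its
-- component in the smaller term and projecting with ε onto the factor of a nonzero orbit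
-- coordinate j of x leaves a nonzero multiple of e_j, and U turns it into a multiple of e_Uj
-- by a unit (±b or ±1), so X is the larger term. The sums in the statement are direct because
-- their summands are spans of disjoint sets of basis vectors.
module Submission where

open import Defs
open import Algebra.Bundles using (CommutativeRing)
open import Data.Nat using (ℕ)
open import Data.Nat.Primality using (Prime)
open import Data.Fin using (Fin)
open import Relation.Binary.PropositionalEquality using (_≢_)

open import Level using (Lift; lift; lower)
open import Data.Bool using (if_then_else_)
open import Data.Bool.Properties using () renaming (_≟_ to _≟ᵇ_)
open import Data.Empty using (⊥-elim)
open import Data.Fin using (zero; suc; combine; #_; _≟_)
open import Data.Fin.Properties using (all?; any?)
open import Data.Fin.Subset using (Subset; ⊥; ⊤; ⁅_⁆; _∪_; ∁; _∈_; _∉_; inside; outside)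
  renaming (_⊆_ to _⊆ˢ_)
open import Data.Fin.Subset.Properties
  using (_∈?_; ∉⊥; ∈⊤; x∈⁅x⁆; x∈⁅y⁆⇒x≡y; p⊆p∪q; q⊆p∪q; x∈p∪q⁻; x∈p∪q⁺; x∈p⇒x∉∁p; x∉p⇒x∈∁p)
open import Data.Product using (Σ; ∃; _×_; _,_; proj₁; proj₂)
open import Data.Sum using (_⊎_; inj₁; inj₂; [_,_]′)
open import Data.Unit using (tt)
open import Data.List using ([]; _∷_)
open import Data.Vec using (Vec; []; _∷_; lookup; map; foldr)
open import Data.Vec.Properties using (≡-dec)
open import Data.Vec.Relation.Unary.All using (All)
open import Data.Vec.Relation.Unary.AllPairs using (AllPairs; allPairs?; []; _∷_)
open import Data.Vec.Relation.Binary.Pointwise.Inductive as Pointwise using (Pointwise; []; _∷_)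
open import Function using (_∘_)
open import Relation.Binary using (Decidable)
import Relation.Binary.Reasoning.Setoid as ≈-Reasoning
open import Relation.Binary.PropositionalEquality as ≡ using (_≡_)
open import Relation.Nullary using (¬_; Dec; yes; no; does; ¬?)
open import Relation.Nullary.Decidable
  using (toWitness; dec-true; dec-false; _×-dec_; _⊎-dec_; _→-dec_)
import Algebra.Properties.Ring as RingProperties
import Algebra.Solver.Ring.NaturalCoefficients.Default as NaturalSolver

pattern c0 = zero
pattern c1 = suc zero
pattern c2 = suc (suc zero)
pattern c3 = suc (suc (suc zero))
pattern c4 = suc (suc (suc (suc zero)))
pattern c5 = suc (suc (suc (suc (suc zero))))
pattern c6 = suc (suc (suc (suc (suc (suc zero)))))
pattern c7 = suc (suc (suc (suc (suc (suc (suc zero))))))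

module _ {c ℓ} (K : CommutativeRing c ℓ) (b b⁻¹ : CommutativeRing.Carrier K) where
  open CommutativeRing K hiding (zero)
  open RingProperties ring using (-1*x≈-x; -‿distribˡ-*; -‿distribʳ-*; -‿involutive)
  open NaturalSolver commutativeSemiring using (solve; _:=_; _:*_)
  open Mb K b b⁻¹

  -- Coordinate 4f + 2e + a of M_b (f, e, a ∈ {0, 1}) is the coefficient of ξ₂^a δ^e 1_{f+1},
  -- where δ = (η₁-η₂)/2.
  coord : Fin 8 → M → Carrier
  coord c0 (((x , _) , _) , _) = x
  coord c1 (((_ , x) , _) , _) = x
  coord c2 ((_ , (x , _)) , _) = x
  coord c3 ((_ , (_ , x)) , _) = x
  coord c4 (_ , ((x , _) , _)) = x
  coord c5 (_ , ((_ , x) , _)) = x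
  coord c6 (_ , (_ , (x , _))) = x
  coord c7 (_ , (_ , (_ , x))) = x

  build : (Fin 8 → Carrier) → M
  build f = ((f c0 , f c1) , (f c2 , f c3)) , ((f c4 , f c5) , (f c6 , f c7))

  coord-build : ∀ k f → coord k (build f) ≡ f k
  coord-build c0 f = ≡.refl
  coord-build c1 f = ≡.refl
  coord-build c2 f = ≡.refl
  coord-build c3 f = ≡.refl
  coord-build c4 f = ≡.refl
  coord-build c5 f = ≡.refl
  coord-build c6 f = ≡.refl
  coord-build c7 f = ≡.refl

  ≈M-intro : ∀ {x y} → (∀ k → coord k x ≈ coord k y) → x ≈M y
  ≈M-intro h = ((h c0 , h c1) , (h c2 , h c3)) , ((h c4 , h c5) , (h c6 , h c7))

  coord-cong : ∀ {x y} → x ≈M y → ∀ k → coord k x ≈ coord k y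
  coord-cong (((p , _) , _) , _) c0 = p
  coord-cong (((_ , p) , _) , _) c1 = p
  coord-cong ((_ , (p , _)) , _) c2 = p
  coord-cong ((_ , (_ , p)) , _) c3 = p
  coord-cong (_ , ((p , _) , _)) c4 = p
  coord-cong (_ , ((_ , p) , _)) c5 = p
  coord-cong (_ , (_ , (p , _))) c6 = p
  coord-cong (_ , (_ , (_ , p))) c7 = p

  ≈M-refl : ∀ {x} → x ≈M x
  ≈M-refl = ≈M-intro λ _ → refl

  ≈M-sym : ∀ {x y} → x ≈M y → y ≈M x
  ≈M-sym p = ≈M-intro λ k → sym (coord-cong p k)

  ≈M-trans : ∀ {x y z} → x ≈M y → y ≈M z → x ≈M z
  ≈M-trans p q = ≈M-intro λ k → trans (coord-cong p k) (coord-cong q k)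

  coord-+ : ∀ k x y → coord k (x +M y) ≡ coord k x + coord k y
  coord-+ k x y = coord-build k (λ m → coord m x + coord m y)

  coord-0 : ∀ k → coord k 0M ≡ 0#
  coord-0 k = coord-build k (λ _ → 0#)

  +M-cong : ∀ {x x' y y'} → x ≈M x' → y ≈M y' → (x +M y) ≈M (x' +M y')
  +M-cong p q = ≈M-intro λ k →
    trans (reflexive (coord-+ k _ _))
      (trans (+-cong (coord-cong p k) (coord-cong q k)) (sym (reflexive (coord-+ k _ _))))

  -- a ⋆ x mixes each coordinate only with its partner, the other ξ₂-power of the same
  -- A-component; ξweight is b at constant terms, where the ξ₂-parts meet in ξ₂² = b.
  partner : Fin 8 → Fin 8
  partner c0 = c1
  partner c1 = c0
  partner c2 = c3
  partner c3 = c2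
  partner c4 = c5
  partner c5 = c4
  partner c6 = c7
  partner c7 = c6

  ξweight : Fin 8 → Carrier
  ξweight c0 = b
  ξweight c1 = 1#
  ξweight c2 = b
  ξweight c3 = 1#
  ξweight c4 = b
  ξweight c5 = 1#
  ξweight c6 = b
  ξweight c7 = 1#

  partner-involutive : ∀ k → partner (partner k) ≡ k
  partner-involutive = toWitness {a? = all? λ k → partner (partner k) ≟ k} tt

  partner-irreflexive : ∀ k → partner k ≢ k
  partner-irreflexive = toWitness {a? = all? λ k → ¬? (partner k ≟ k)} tt

  ξweight-partner : ∀ k → ξweight (partner k) * ξweight k ≈ b
  ξweight-partner c0 = *-identityˡ b
  ξweight-partner c1 = *-identityʳ b
  ξweight-partner c2 = *-identityˡ b
  ξweight-partner c3 = *-identityʳ b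
  ξweight-partner c4 = *-identityˡ b
  ξweight-partner c5 = *-identityʳ b
  ξweight-partner c6 = *-identityˡ b
  ξweight-partner c7 = *-identityʳ b

  coord-⋆ : ∀ a k x →
    coord k (a ⋆ x) ≈ proj₁ a * coord k x + (ξweight k * proj₂ a) * coord (partner k) x
  coord-⋆ a c0 x = +-congˡ (sym (*-assoc b _ _))
  coord-⋆ a c1 x = +-congˡ (*-congʳ (sym (*-identityˡ _)))
  coord-⋆ a c2 x = +-congˡ (sym (*-assoc b _ _))
  coord-⋆ a c3 x = +-congˡ (*-congʳ (sym (*-identityˡ _)))
  coord-⋆ a c4 x = +-congˡ (sym (*-assoc b _ _))
  coord-⋆ a c5 x = +-congˡ (*-congʳ (sym (*-identityˡ _)))
  coord-⋆ a c6 x = +-congˡ (sym (*-assoc b _ _))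
  coord-⋆ a c7 x = +-congˡ (*-congʳ (sym (*-identityˡ _)))

  coord-• : ∀ t k x → coord k (t • x) ≈ t * coord k x
  coord-• t k x = trans (coord-⋆ (t , 0#) k x)
    (trans (+-congˡ (trans (*-congʳ (zeroʳ _)) (zeroˡ _))) (+-identityʳ _))

  masked : Subset 8 → M → Fin 8 → Carrier
  masked s x k = if does (k ∈? s) then coord k x else 0#

  mask : Subset 8 → M → M
  mask s x = build (masked s x)

  coord-mask-∈ : ∀ {k s} x → k ∈ s → coord k (mask s x) ≡ coord k x
  coord-mask-∈ {k} {s} x k∈s = ≡.trans (coord-build k (masked s x))
    (≡.cong (λ β → if β then coord k x else 0#) (dec-true (k ∈? s) k∈s))

  coord-mask-∉ : ∀ {k s} x → k ∉ s → coord k (mask s x) ≡ 0#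
  coord-mask-∉ {k} {s} x k∉s = ≡.trans (coord-build k (masked s x))
    (≡.cong (λ β → if β then coord k x else 0#) (dec-false (k ∈? s) k∉s))

  coord-mask-≈0 : ∀ k s x → coord k x ≈ 0# → coord k (mask s x) ≈ 0#
  coord-mask-≈0 k s x xₖ≈0 with k ∈? s
  ... | yes k∈s = trans (reflexive (coord-mask-∈ x k∈s)) xₖ≈0
  ... | no  k∉s = reflexive (coord-mask-∉ x k∉s)

  factor : Fin 2 → Subset 8
  factor zero       = inside  ∷ inside  ∷ inside  ∷ inside  ∷ outside ∷ outside ∷ outside ∷ outside
                    ∷ []
  factor (suc zero) = outside ∷ outside ∷ outside ∷ outside ∷ inside  ∷ inside  ∷ inside  ∷ inside
                    ∷ []

  actε-mask : ∀ i x → actε i x ≡ mask (factor i) x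
  actε-mask zero       x = ≡.refl
  actε-mask (suc zero) x = ≡.refl

  e : Fin 8 → M
  e k = mask ⁅ k ⁆ (build λ _ → 1#)

  coord-e-self : ∀ k → coord k (e k) ≡ 1#
  coord-e-self k = ≡.trans (coord-mask-∈ _ (x∈⁅x⁆ k)) (coord-build k _)

  coord-e-other : ∀ {m k} → m ≢ k → coord m (e k) ≡ 0#
  coord-e-other m≢k = coord-mask-∉ _ (m≢k ∘ x∈⁅y⁆⇒x≡y _)

  index : Fin 2 → Fin 4 → Fin 8
  index = combine

  one-e : ∀ i → one i ≡ e (index i (# 0))
  one-e zero       = ≡.refl
  one-e (suc zero) = ≡.refl

  δone-e : ∀ i → δone i ≡ e (index i (# 2))
  δone-e zero       = ≡.refl
  δone-e (suc zero) = ≡.refl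

  -- Spans of basis vectors

  Span : Subset 8 → Sub
  Span s x = Lift L (∀ k → k ∉ s → coord k x ≈ 0#)

  Span-resp : ∀ {s x y} → x ≈M y → Span s x → Span s y
  Span-resp x≈y (lift x∈) = lift λ k k∉s → trans (sym (coord-cong x≈y k)) (x∈ k k∉s)

  Span-0 : ∀ {s} → Span s 0M
  Span-0 = lift λ k _ → reflexive (coord-0 k)

  Span-+ : ∀ {s x y} → Span s x → Span s y → Span s (x +M y)
  Span-+ {x = x} {y} (lift x∈) (lift y∈) = lift λ k k∉s →
    trans (reflexive (coord-+ k x y)) (trans (+-cong (x∈ k k∉s) (y∈ k k∉s)) (+-identityʳ 0#))

  Span-• : ∀ {s x} t → Span s x → Span s (t • x)
  Span-• {x = x} t (lift x∈) = lift λ k k∉s →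
    trans (coord-• t k x) (trans (*-congˡ (x∈ k k∉s)) (zeroʳ t))

  Span-mask : ∀ {s x} t → Span s x → Span s (mask t x)
  Span-mask {x = x} t (lift x∈) = lift λ k k∉s → coord-mask-≈0 k t x (x∈ k k∉s)

  mask-Span : ∀ s x → Span s (mask s x)
  mask-Span s x = lift λ k k∉s → reflexive (coord-mask-∉ x k∉s)

  Span-mono : ∀ {s t} → s ⊆ˢ t → Span s ⊆ Span t
  Span-mono s⊆t x (lift x∈) = lift λ k k∉t → x∈ k (k∉t ∘ s⊆t)

  Span-≡ : ∀ {s t} → s ≡ t → Span s ≐ Span t
  Span-≡ ≡.refl = (λ _ x∈ → x∈) , (λ _ x∈ → x∈)

  Span-⊥ : Span ⊥ ≐ ZeroSub
  Span-⊥ = (λ x (lift x∈) → lift (≈M-intro λ k → trans (x∈ k ∉⊥) (sym (reflexive (coord-0 k)))))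
         , (λ x (lift x≈0) → lift λ k _ → trans (coord-cong x≈0 k) (reflexive (coord-0 k)))

  Span-⊤ : Span ⊤ ≐ Full
  Span-⊤ = (λ _ _ → lift tt) , (λ _ _ → lift λ k k∉⊤ → ⊥-elim (k∉⊤ ∈⊤))

  ≡⇒∈⁅⁆ : ∀ {m k : Fin 8} → m ≡ k → m ∈ ⁅ k ⁆
  ≡⇒∈⁅⁆ {k = k} ≡.refl = x∈⁅x⁆ k

  e-Span : ∀ k → Span ⁅ k ⁆ (e k)
  e-Span k = lift λ m m∉⁅k⁆ → reflexive (coord-e-other (m∉⁅k⁆ ∘ ≡⇒∈⁅⁆))

  mask-split : ∀ s x → x ≈M (mask s x +M mask (∁ s) x)
  mask-split s x = ≈M-intro λ k → trans (split k) (sym (reflexive (coord-+ k _ _)))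
    where
    split : ∀ k → coord k x ≈ coord k (mask s x) + coord k (mask (∁ s) x)
    split k with k ∈? s
    ... | yes k∈s = sym (trans (+-cong (reflexive (coord-mask-∈ x k∈s))
                                       (reflexive (coord-mask-∉ x (x∈p⇒x∉∁p k∈s))))
                               (+-identityʳ _))
    ... | no  k∉s = sym (trans (+-cong (reflexive (coord-mask-∉ x k∉s))
                                       (reflexive (coord-mask-∈ x (x∉p⇒x∈∁p k∉s))))
                               (+-identityˡ _))

  ∉-∪ : ∀ {k} {s t : Subset 8} → k ∉ s → k ∉ t → k ∉ s ∪ t
  ∉-∪ {s = s} {t} k∉s k∉t k∈s∪t with x∈p∪q⁻ s t k∈s∪t
  ... | inj₁ k∈s = k∉s k∈s
  ... | inj₂ k∈t = k∉t k∈t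

  mask-∁-Span : ∀ {s t x} → Span (s ∪ t) x → Span t (mask (∁ s) x)
  mask-∁-Span {s} {t} {x} (lift x∈) = lift λ k k∉t → vanish k k∉t
    where
    vanish : ∀ k → k ∉ t → coord k (mask (∁ s) x) ≈ 0#
    vanish k k∉t with k ∈? s
    ... | yes k∈s = reflexive (coord-mask-∉ x (x∈p⇒x∉∁p k∈s))
    ... | no  k∉s = coord-mask-≈0 k (∁ s) x (x∈ k (∉-∪ k∉s k∉t))

  -- Monomial operators

  record Monomial (op : M → M) : Set L where
    field
      source   : Fin 8 → Fin 8
      weight   : Fin 8 → Carrier
      coord-op : ∀ k x → coord k (op x) ≈ weight k * coord (source k) x

  Closed : (Fin 8 → Fin 8) → Subset 8 → Set
  Closed π s = ∀ k → k ∉ s → π k ∉ s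

  closed? : ∀ π s → Dec (Closed π s)
  closed? π s = all? λ k → ¬? (k ∈? s) →-dec ¬? (π k ∈? s)

  Closed-⊥ : ∀ π → Closed π ⊥
  Closed-⊥ π _ _ = ∉⊥

  Closed-⊤ : ∀ π → Closed π ⊤
  Closed-⊤ π k k∉⊤ = ⊥-elim (k∉⊤ ∈⊤)

  Span-monomial : ∀ {op s x} (m : Monomial op) → Closed (Monomial.source m) s →
                  Span s x → Span s (op x)
  Span-monomial {x = x} m closed (lift x∈) = lift λ k k∉s →
    trans (coord-op k x) (trans (*-congˡ (x∈ (source k) (closed k k∉s))) (zeroʳ _))
    where open Monomial m

  -- actU and actU⁻¹ are definitionally actUBy ξA and actUBy ξA⁻¹.
  actUBy : A → M → M
  actUBy u x = proj zero (diag op (perm x)) +M proj (suc zero) (diag op (perm x))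
    where
    op : Comp → Comp
    op (f , g) = (-A (u *A f)) , (u *A g)

  πU : Fin 8 → Fin 8
  πU c0 = c5
  πU c1 = c4
  πU c2 = c7
  πU c3 = c6
  πU c4 = c1
  πU c5 = c0
  πU c6 = c3
  πU c7 = c2

  πU-involutive : ∀ k → πU (πU k) ≡ k
  πU-involutive = toWitness {a? = all? λ k → πU (πU k) ≟ k} tt

  Uweight : Carrier → Fin 8 → Carrier
  Uweight w c0 = - (b * w)
  Uweight w c1 = - w
  Uweight w c2 = b * w
  Uweight w c3 = w
  Uweight w c4 = - (b * w)
  Uweight w c5 = - w
  Uweight w c6 = b * w
  Uweight w c7 = w

  actUBy-monomial : ∀ w → Monomial (actUBy (0# , w))
  actUBy-monomial w = record { source = πU ; weight = Uweight w ; coord-op = coord-U }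
    where
    even : ∀ x y → 0# * x + b * (w * y) ≈ (b * w) * y
    even x y = trans (+-cong (zeroˡ x) (sym (*-assoc b w y))) (+-identityˡ _)
    odd : ∀ x y → 0# * x + w * y ≈ w * y
    odd x y = trans (+-congʳ (zeroˡ x)) (+-identityˡ _)
    negated : ∀ {p q y} → p ≈ q * y → - p ≈ (- q) * y
    negated p≈ = trans (-‿cong p≈) (-‿distribˡ-* _ _)
    coord-U : ∀ k x → coord k (actUBy (0# , w) x) ≈ Uweight w k * coord (πU k) x
    coord-U c0 x = trans (+-identityʳ _) (negated (even _ _))
    coord-U c1 x = trans (+-identityʳ _) (negated (odd _ _))
    coord-U c2 x = trans (+-identityʳ _) (even _ _)
    coord-U c3 x = trans (+-identityʳ _) (odd _ _)
    coord-U c4 x = trans (+-identityˡ _) (negated (even _ _))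
    coord-U c5 x = trans (+-identityˡ _) (negated (odd _ _))
    coord-U c6 x = trans (+-identityˡ _) (even _ _)
    coord-U c7 x = trans (+-identityˡ _) (odd _ _)

  U-monomial : Monomial actU
  U-monomial = actUBy-monomial 1#

  U⁻¹-monomial : Monomial actU⁻¹
  U⁻¹-monomial = actUBy-monomial b⁻¹

  πS : Fin 8 → Fin 8
  πS c0 = c6
  πS c1 = c7
  πS c2 = c2
  πS c3 = c3
  πS c4 = c2
  πS c5 = c3
  πS c6 = c6
  πS c7 = c7

  Sweight : Fin 8 → Carrier
  Sweight c0 = - 1#
  Sweight c1 = - 1#
  Sweight c2 = 0#
  Sweight c3 = 0#
  Sweight c4 = - 1#
  Sweight c5 = - 1#
  Sweight c6 = 0#
  Sweight c7 = 0#

  S-monomial : Monomial actS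
  S-monomial = record { source = πS ; weight = Sweight ; coord-op = coord-S }
    where
    coord-S : ∀ k x → coord k (actS x) ≈ Sweight k * coord (πS k) x
    coord-S c0 x = trans (+-identityʳ _) (sym (-1*x≈-x _))
    coord-S c1 x = trans (+-identityʳ _) (sym (-1*x≈-x _))
    coord-S c2 x = trans (+-identityʳ 0#) (sym (zeroˡ _))
    coord-S c3 x = trans (+-identityʳ 0#) (sym (zeroˡ _))
    coord-S c4 x = trans (+-identityˡ _) (sym (-1*x≈-x _))
    coord-S c5 x = trans (+-identityˡ _) (sym (-1*x≈-x _))
    coord-S c6 x = trans (+-identityˡ 0#) (sym (zeroˡ _))
    coord-S c7 x = trans (+-identityˡ 0#) (sym (zeroˡ _))

  Stable : Subset 8 → Set
  Stable s = Closed πS s × Closed πU s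

  Span-isSubmodule : ∀ {s} → Stable s → IsSubmodule (Span s)
  Span-isSubmodule (S-closed , U-closed) = record
    { respects  = Span-resp
    ; has0      = Span-0
    ; add       = Span-+
    ; scale     = λ t → Span-• t
    ; closedε   = λ i {x} x∈ → ≡.subst (Span _) (≡.sym (actε-mask i x)) (Span-mask (factor i) x∈)
    ; closedS   = Span-monomial S-monomial S-closed
    ; closedU   = Span-monomial U-monomial U-closed
    ; closedU⁻¹ = Span-monomial U⁻¹-monomial U-closed
    }

  ≐-refl : ∀ {V} → V ≐ V
  ≐-refl = (λ _ v → v) , (λ _ v → v)

  ≐-sym : ∀ {V W} → V ≐ W → W ≐ V
  ≐-sym (V⊆W , W⊆V) = W⊆V , V⊆W

  ≐-trans : ∀ {U V W} → U ≐ V → V ≐ W → U ≐ W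
  ≐-trans (U⊆V , V⊆U) (V⊆W , W⊆V) = (λ x → V⊆W x ∘ U⊆V x) , (λ x → V⊆U x ∘ W⊆V x)

  IsSubmodule-≐ : ∀ {V W} → V ≐ W → IsSubmodule W → IsSubmodule V
  IsSubmodule-≐ (V⊆W , W⊆V) W-sub = record
    { respects  = λ x≈y → W⊆V _ ∘ respects x≈y ∘ V⊆W _
    ; has0      = W⊆V _ has0
    ; add       = λ x∈ y∈ → W⊆V _ (add (V⊆W _ x∈) (V⊆W _ y∈))
    ; scale     = λ t → W⊆V _ ∘ scale t ∘ V⊆W _
    ; closedε   = λ i → W⊆V _ ∘ closedε i ∘ V⊆W _
    ; closedS   = W⊆V _ ∘ closedS ∘ V⊆W _
    ; closedU   = W⊆V _ ∘ closedU ∘ V⊆W _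
    ; closedU⁻¹ = W⊆V _ ∘ closedU⁻¹ ∘ V⊆W _
    }
    where open IsSubmodule W-sub

  SimpleSubquotient-≐ : ∀ {V V' W W'} → V ≐ V' → W ≐ W' →
                        SimpleSubquotient V' W' → SimpleSubquotient V W
  SimpleSubquotient-≐ (V⊆V' , V'⊆V) (W⊆W' , W'⊆W) (V'⊆W' , (x , x∈W' , x∉V') , maximal) =
      (λ y → W'⊆W y ∘ V'⊆W' y ∘ V⊆V' y)
    , (x , W'⊆W x x∈W' , x∉V' ∘ V⊆V' x)
    , λ X X-sub V⊆X X⊆W (y , y∈X , y∉V) z z∈W →
        maximal X X-sub (λ u → V⊆X u ∘ V'⊆V u) (λ u → W⊆W' u ∘ X⊆W u)
                (y , y∈X , y∉V ∘ V'⊆V y) z (W⊆W' z z∈W)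

  -- Sums of spans of basis vectors

  SumOf-mono : ∀ {n} {Ws Ws' : Vec Sub n} → (∀ j → lookup Ws j ⊆ lookup Ws' j) →
               SumOf Ws ⊆ SumOf Ws'
  SumOf-mono Ws⊆Ws' x (xs , xs∈ , x≈) = xs , (λ j → Ws⊆Ws' j _ (xs∈ j)) , x≈

  IsDirect-mono : ∀ {n} {Ws Ws' : Vec Sub n} → (∀ j → lookup Ws j ⊆ lookup Ws' j) →
                  IsDirect Ws' → IsDirect Ws
  IsDirect-mono Ws⊆Ws' direct xs xs∈ = direct xs (λ j → Ws⊆Ws' j _ (xs∈ j))

  unionOf : ∀ {n} → Vec (Subset 8) n → Subset 8
  unionOf = foldr _ _∪_ ⊥

  SumOf-Span : ∀ {n} (ss : Vec (Subset 8) n) → SumOf (map Span ss) ≐ Span (unionOf ss)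
  SumOf-Span [] = (λ { x ([] , _ , x≈0) → Span-resp (≈M-sym x≈0) Span-0 })
                , (λ x x∈ → [] , (λ ()) , lower (proj₁ Span-⊥ x x∈))
  SumOf-Span (s ∷ ss) = sum⊆ , ⊆sum
    where
    sum⊆ : SumOf (map Span (s ∷ ss)) ⊆ Span (s ∪ unionOf ss)
    sum⊆ x (y ∷ ys , ys∈ , x≈) = Span-resp (≈M-sym x≈)
      (Span-+ (Span-mono (p⊆p∪q _) _ (ys∈ zero))
              (Span-mono (q⊆p∪q s _) _ (proj₁ (SumOf-Span ss) _ (ys , ys∈ ∘ suc , ≈M-refl))))
    ⊆sum : Span (s ∪ unionOf ss) ⊆ SumOf (map Span (s ∷ ss))
    ⊆sum x x∈ with proj₂ (SumOf-Span ss) _ (mask-∁-Span x∈)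
    ... | ys , ys∈ , rest≈ = mask s x ∷ ys
                           , (λ { zero → mask-Span s x ; (suc j) → ys∈ j })
                           , ≈M-trans (mask-split s x) (+M-cong ≈M-refl rest≈)

  Disjoint : Subset 8 → Subset 8 → Set
  Disjoint s t = ∀ k → k ∈ s → k ∉ t

  disjoint? : ∀ s t → Dec (Disjoint s t)
  disjoint? s t = all? λ k → (k ∈? s) →-dec ¬? (k ∈? t)

  Disjoint-unionOf : ∀ {n s} {ts : Vec (Subset 8) n} → All (Disjoint s) ts → Disjoint s (unionOf ts)
  Disjoint-unionOf All.[] k _ = ∉⊥
  Disjoint-unionOf {s = s} {t ∷ ts} (s#t All.∷ s#ts) k k∈s =
    ∉-∪ (s#t k k∈s) (Disjoint-unionOf s#ts k k∈s)

  Span-disjoint-sum : ∀ {s t x y} → Disjoint s t → Span s x → Span t y →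
                      (x +M y) ≈M 0M → x ≈M 0M × y ≈M 0M
  Span-disjoint-sum {s} {t} {x} {y} s#t (lift x∈) (lift y∈) sum≈0 =
    ≈M-intro (λ k → trans (proj₁ (vanish k)) (sym (reflexive (coord-0 k)))) ,
    ≈M-intro (λ k → trans (proj₂ (vanish k)) (sym (reflexive (coord-0 k))))
    where
    sum : ∀ k → coord k x + coord k y ≈ 0#
    sum k = trans (sym (reflexive (coord-+ k x y)))
                  (trans (coord-cong sum≈0 k) (reflexive (coord-0 k)))
    vanish : ∀ k → coord k x ≈ 0# × coord k y ≈ 0#
    vanish k with k ∈? s
    ... | yes k∈s = let yₖ≈0 = y∈ k (s#t k k∈s) in
                    trans (sym (trans (+-congˡ yₖ≈0) (+-identityʳ _))) (sum k) , yₖ≈0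
    ... | no  k∉s = let xₖ≈0 = x∈ k k∉s in
                    xₖ≈0 , trans (sym (trans (+-congʳ xₖ≈0) (+-identityˡ _))) (sum k)

  IsDirect-Span : ∀ {n} {ss : Vec (Subset 8) n} → AllPairs Disjoint ss → IsDirect (map Span ss)
  IsDirect-Span {ss = []} [] [] _ _ ()
  IsDirect-Span {ss = s ∷ ss} (s#ss ∷ ss-disjoint) (y ∷ ys) ys∈ sum≈0 = λ
    { zero    → proj₁ parts
    ; (suc j) → IsDirect-Span ss-disjoint ys (ys∈ ∘ suc) (proj₂ parts) j }
    where
    parts = Span-disjoint-sum (Disjoint-unionOf s#ss) (ys∈ zero)
              (proj₁ (SumOf-Span ss) _ (ys , ys∈ ∘ suc , ≈M-refl)) sum≈0

  Partition : ∀ {n} → Vec (Subset 8) n → Subset 8 → Set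
  Partition ss s = AllPairs Disjoint ss × unionOf ss ≡ s

  partition? : ∀ {n} (ss : Vec (Subset 8) n) s → Dec (Partition ss s)
  partition? ss s = allPairs? disjoint? ss ×-dec ≡-dec _≟ᵇ_ (unionOf ss) s

  direct-sum-of-Spans : ∀ {n} {Ws : Vec Sub n} {ss : Vec (Subset 8) n} {s} →
    Pointwise _≐_ Ws (map Span ss) → Partition ss s → IsDirect Ws × (SumOf Ws ≐ Span s)
  direct-sum-of-Spans {Ws = Ws} {ss} Ws≐ (ss-disjoint , ≡.refl) =
      IsDirect-mono {Ws = Ws} {map Span ss} Ws⊆ (IsDirect-Span ss-disjoint)
    , ≐-trans (SumOf-mono {Ws = Ws} {map Span ss} Ws⊆ , SumOf-mono {Ws = map Span ss} {Ws} ⊇Ws)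
              (SumOf-Span ss)
    where
    Ws⊆ : ∀ j → lookup Ws j ⊆ lookup (map Span ss) j
    Ws⊆ = proj₁ ∘ Pointwise.lookup Ws≐
    ⊇Ws : ∀ j → lookup (map Span ss) j ⊆ lookup Ws j
    ⊇Ws = proj₂ ∘ Pointwise.lookup Ws≐

  -- Unit multiples of basis vectors

  Invertible : Carrier → Set L
  Invertible x = Σ Carrier λ d → d * x ≈ 1#

  Invertible-resp : ∀ {x y} → x ≈ y → Invertible x → Invertible y
  Invertible-resp x≈y (d , dx≈1) = d , trans (*-congˡ (sym x≈y)) dx≈1

  1-invertible : Invertible 1#
  1-invertible = 1# , *-identityˡ 1#

  *-invertible : ∀ {x y} → Invertible x → Invertible y → Invertible (x * y)
  *-invertible {x} {y} (d , dx≈1) (d' , d'y≈1) = d' * d , (begin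
    (d' * d) * (x * y)  ≈⟨ swap d' d x y ⟩
    (d * x) * (d' * y)  ≈⟨ *-cong dx≈1 d'y≈1 ⟩
    1# * 1#             ≈⟨ *-identityˡ 1# ⟩
    1#                  ∎)
    where
    open ≈-Reasoning setoid
    swap : ∀ d' d x y → (d' * d) * (x * y) ≈ (d * x) * (d' * y)
    swap = solve 4 (λ d' d x y → (d' :* d) :* (x :* y) := (d :* x) :* (d' :* y)) refl

  -‿invertible : ∀ {x} → Invertible x → Invertible (- x)
  -‿invertible {x} (d , dx≈1) = - d , (begin
    - d * - x      ≈⟨ -‿distribˡ-* d (- x) ⟨
    - (d * - x)    ≈⟨ -‿cong (-‿distribʳ-* d x) ⟨
    - - (d * x)    ≈⟨ -‿involutive _ ⟩
    d * x          ≈⟨ dx≈1 ⟩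
    1#             ∎)
    where open ≈-Reasoning setoid

  UnitMultiple : Fin 8 → M → Set L
  UnitMultiple k v = Span ⁅ k ⁆ v × Invertible (coord k v)

  e-UnitMultiple : ∀ k → UnitMultiple k (e k)
  e-UnitMultiple k = e-Span k , Invertible-resp (sym (reflexive (coord-e-self k))) 1-invertible

  Span-⁅⁆-off : ∀ {k v m} → Span ⁅ k ⁆ v → m ≢ k → coord m v ≈ 0#
  Span-⁅⁆-off (lift v∈) m≢k = v∈ _ (m≢k ∘ x∈⁅y⁆⇒x≡y _)

  Monomial-UnitMultiple : ∀ {op k v} (m : Monomial op) →
    (∀ k → Monomial.source m (Monomial.source m k) ≡ k) →
    (∀ k → Invertible (Monomial.weight m k)) →
    UnitMultiple k v → UnitMultiple (Monomial.source m k) (op v)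
  Monomial-UnitMultiple {op} {k} {v} m source-involutive weight-invertible (v∈ , vₖ-invertible) =
    lift vanish , Invertible-resp (sym (coord-op (source k) v)) image-invertible
    where
    open Monomial m
    vanish : ∀ j → j ∉ ⁅ source k ⁆ → coord j (op v) ≈ 0#
    vanish j j∉ = trans (coord-op j v) (trans (*-congˡ (Span-⁅⁆-off v∈ source-j≢k)) (zeroʳ _))
      where
      source-j≢k : source j ≢ k
      source-j≢k sj≡k = j∉ (≡⇒∈⁅⁆ (≡.trans (≡.sym (source-involutive j)) (≡.cong source sj≡k)))
    image-invertible : Invertible (weight (source k) * coord (source (source k)) v)
    image-invertible = *-invertible (weight-invertible (source k))
      (≡.subst (λ j → Invertible (coord j v)) (≡.sym (source-involutive k)) vₖ-invertible)

  cancel : ∀ {d v} x → d * v ≈ 1# → (d * x) * v ≈ x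
  cancel {d} {v} x dv≈1 =
    trans (solve 3 (λ d x v → (d :* x) :* v := (d :* v) :* x) refl d x v)
          (trans (*-congʳ dv≈1) (*-identityˡ x))

  kSpan-UnitMultiple : ∀ {k v} → UnitMultiple k v → kSpan v ≐ Span ⁅ k ⁆
  kSpan-UnitMultiple {k} {v} (v∈ , d , dvₖ≈1) =
      (λ x (t , x≈) → Span-resp (≈M-sym x≈) (Span-• t v∈))
    , λ x x∈ → d * coord k x , ≈M-intro (λ m → sym (trans (coord-• _ m v) (expand m x∈)))
    where
    expand : ∀ {x} m → Span ⁅ k ⁆ x → (d * coord k x) * coord m v ≈ coord m x
    expand {x} m x∈ with m ≟ k
    ... | yes ≡.refl = cancel _ dvₖ≈1
    ... | no  m≢k    = trans (*-congˡ (Span-⁅⁆-off v∈ m≢k))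
                             (trans (zeroʳ _) (sym (Span-⁅⁆-off x∈ m≢k)))

  ξ-pair : Fin 8 → Subset 8
  ξ-pair k = ⁅ k ⁆ ∪ ⁅ partner k ⁆

  coord-⋆-self : ∀ {k v} a → Span ⁅ k ⁆ v → coord k (a ⋆ v) ≈ proj₁ a * coord k v
  coord-⋆-self {k} {v} a v∈ = trans (coord-⋆ a k v)
    (trans (+-congˡ (trans (*-congˡ (Span-⁅⁆-off v∈ (partner-irreflexive k))) (zeroʳ _)))
           (+-identityʳ _))

  coord-⋆-partner : ∀ {k v} a → Span ⁅ k ⁆ v →
                    coord (partner k) (a ⋆ v) ≈ (ξweight (partner k) * proj₂ a) * coord k v
  coord-⋆-partner {k} {v} a v∈ = trans (coord-⋆ a (partner k) v)
    (trans (+-cong (trans (*-congˡ (Span-⁅⁆-off v∈ (partner-irreflexive k))) (zeroʳ _))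
                   (*-congˡ (reflexive (≡.cong (λ j → coord j v) (partner-involutive k)))))
           (+-identityˡ _))

  coord-⋆-elsewhere : ∀ {k v m} a → Span ⁅ k ⁆ v → m ∉ ξ-pair k → coord m (a ⋆ v) ≈ 0#
  coord-⋆-elsewhere {k} {v} {m} a v∈ m∉ = trans (coord-⋆ a m v)
    (trans (+-cong (*-congˡ (Span-⁅⁆-off v∈ m≢k)) (*-congˡ (Span-⁅⁆-off v∈ partner-m≢k)))
      (trans (+-cong (zeroʳ _) (zeroʳ _)) (+-identityʳ 0#)))
    where
    m≢k : m ≢ k
    m≢k = m∉ ∘ x∈p∪q⁺ ∘ inj₁ ∘ ≡⇒∈⁅⁆
    partner-m≢k : partner m ≢ k
    partner-m≢k pm≡k = m∉ (x∈p∪q⁺ (inj₂ (≡⇒∈⁅⁆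
      (≡.trans (≡.sym (partner-involutive m)) (≡.cong partner pm≡k)))))

  ASpan-UnitMultiple : ∀ {k v} → b * b⁻¹ ≈ 1# → UnitMultiple k v → ASpan v ≐ Span (ξ-pair k)
  ASpan-UnitMultiple {k} {v} b*b⁻¹≈1 (v∈ , d , dvₖ≈1) =
      (λ x (a , x≈) → Span-resp (≈M-sym x≈) (lift λ m → coord-⋆-elsewhere a v∈))
    , λ x x∈ → coefficient x , ≈M-intro (λ m → sym (expand m x∈))
    where
    -- b⁻¹ compensates ξweight (partner k) * ξweight k = b
    coefficient : M → A
    coefficient x = d * coord k x , d * (ξweight k * (b⁻¹ * coord (partner k) x))
    at-partner : ∀ y → (ξweight (partner k) * (d * (ξweight k * (b⁻¹ * y)))) * coord k v ≈ y
    at-partner y = begin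
      (ξweight (partner k) * (d * (ξweight k * (b⁻¹ * y)))) * coord k v
        ≈⟨ solve 6 (λ w' w c y d v → (w' :* (d :* (w :* (c :* y)))) :* v
                                  := ((w' :* w) :* c) :* ((d :* y) :* v)) refl _ _ b⁻¹ y d _ ⟩
      ((ξweight (partner k) * ξweight k) * b⁻¹) * ((d * y) * coord k v)
        ≈⟨ *-cong (trans (*-congʳ (ξweight-partner k)) b*b⁻¹≈1) (cancel y dvₖ≈1) ⟩
      1# * y
        ≈⟨ *-identityˡ y ⟩
      y ∎
      where open ≈-Reasoning setoid
    expand : ∀ {x} m → Span (ξ-pair k) x → coord m (coefficient x ⋆ v) ≈ coord m x
    expand {x} m (lift x∈) with m ≟ k | m ≟ partner k
    ... | yes ≡.refl | _          = trans (coord-⋆-self _ v∈) (cancel _ dvₖ≈1)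
    ... | no _       | yes ≡.refl = trans (coord-⋆-partner _ v∈) (at-partner _)
    ... | no m≢k     | no m≢pk    = trans (coord-⋆-elsewhere _ v∈ m∉) (sym (x∈ m m∉))
      where
      m∉ : m ∉ ξ-pair k
      m∉ = ∉-∪ (m≢k ∘ x∈⁅y⁆⇒x≡y k) (m≢pk ∘ x∈⁅y⁆⇒x≡y _)

  Span-∪-⊆ : ∀ {X s t} → IsSubmodule X → Span s ⊆ X → Span t ⊆ X → Span (s ∪ t) ⊆ X
  Span-∪-⊆ {s = s} X-sub s⊆X t⊆X x x∈ =
    respects (≈M-sym (mask-split s x)) (add (s⊆X _ (mask-Span s x)) (t⊆X _ (mask-∁-Span x∈)))
    where open IsSubmodule X-sub

  Span-⁅⁆-⊆ : ∀ {X k y} → IsSubmodule X → UnitMultiple k y → X y → Span ⁅ k ⁆ ⊆ X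
  Span-⁅⁆-⊆ X-sub y-unit y∈X x x∈ with proj₂ (kSpan-UnitMultiple y-unit) x x∈
  ... | t , x≈ = respects (≈M-sym x≈) (scale t y∈X)
    where open IsSubmodule X-sub

  mask-∁-∈ : ∀ {X s x} → IsSubmodule X → Span s ⊆ X → X x → X (mask (∁ s) x)
  mask-∁-∈ {s = s} {x} X-sub s⊆X x∈X =
    respects difference (add x∈X (scale (- 1#) (s⊆X _ (mask-Span s x))))
    where
    open IsSubmodule X-sub
    difference : (x +M ((- 1#) • mask s x)) ≈M mask (∁ s) x
    difference = ≈M-intro λ k → begin
      coord k (x +M ((- 1#) • mask s x))          ≡⟨ coord-+ k _ _ ⟩
      coord k x + coord k ((- 1#) • mask s x)    ≈⟨ +-congˡ (trans (coord-• _ k _) (-1*x≈-x _)) ⟩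
      coord k x - coord k (mask s x)             ≈⟨ +-congʳ (coord-cong (mask-split s x) k) ⟩
      coord k (mask s x +M mask (∁ s) x) - coord k (mask s x)
        ≡⟨ ≡.cong (_- coord k (mask s x)) (coord-+ k _ _) ⟩
      (coord k (mask s x) + coord k (mask (∁ s) x)) - coord k (mask s x)
        ≈⟨ +-congʳ (+-comm _ _) ⟩
      (coord k (mask (∁ s) x) + coord k (mask s x)) - coord k (mask s x)
        ≈⟨ +-assoc _ _ _ ⟩
      coord k (mask (∁ s) x) + (coord k (mask s x) - coord k (mask s x))
        ≈⟨ +-congˡ (-‿inverseʳ _) ⟩
      coord k (mask (∁ s) x) + 0#                ≈⟨ +-identityʳ _ ⟩
      coord k (mask (∁ s) x)                     ∎
      where open ≈-Reasoning setoid

  -- The chain of U-orbits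

  orbit : Fin 8 → Subset 8
  orbit k = ⁅ k ⁆ ∪ ⁅ πU k ⁆

  orbit-∋ : ∀ k → k ∈ orbit k × πU k ∈ orbit k
  orbit-∋ k = x∈p∪q⁺ (inj₁ (x∈⁅x⁆ k)) , x∈p∪q⁺ (inj₂ (x∈⁅x⁆ (πU k)))

  orbit-members : ∀ j k k' → k ∈ orbit j → k' ∈ orbit j → k ≡ k' ⊎ k ≡ πU k'
  orbit-members = toWitness {a? = all? λ j → all? λ k → all? λ k' →
    (k ∈? orbit j) →-dec (k' ∈? orbit j) →-dec ((k ≟ k') ⊎-dec (k ≟ πU k'))} tt

  orbit-meets-factor-once : ∀ j k k' i → k ∈ orbit j → k' ∈ orbit j →
                            k ∈ factor i → k' ∈ factor i → k ≡ k'
  orbit-meets-factor-once = toWitness {a? = all? λ j → all? λ k → all? λ k' → all? λ i →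
    (k ∈? orbit j) →-dec (k' ∈? orbit j) →-dec (k ∈? factor i) →-dec (k' ∈? factor i) →-dec
    (k ≟ k')} tt

  factor-cover : ∀ k → ∃ λ i → k ∈ factor i
  factor-cover = toWitness {a? = all? λ k → any? λ i → k ∈? factor i} tt

  layer₁ layer₂ layer₃ : Fin 2 → Subset 8
  layer₁ i = ⊥ ∪ orbit (index i (# 0))
  layer₂ i = layer₁ i ∪ orbit (index i (# 1))
  layer₃ i = layer₂ i ∪ orbit (index i (# 2))

  summands₁ summands₂ summands₂' : Fin 2 → Vec (Subset 8) 2
  summands₁ i  = ⁅ index i (# 0) ⁆ ∷ ⁅ πU (index i (# 0)) ⁆ ∷ []
  summands₂ i  = ξ-pair (index i (# 0)) ∷ ξ-pair (πU (index i (# 0))) ∷ []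
  summands₂' i = ξ-pair (index i (# 0)) ∷ ξ-pair (index (other i) (# 0)) ∷ []

  summands₃ : Fin 2 → Vec (Subset 8) 4
  summands₃ i = ξ-pair (index i (# 0)) ∷ ξ-pair (index (other i) (# 0))
              ∷ ⁅ index i (# 2) ⁆ ∷ ⁅ πU (index i (# 2)) ⁆ ∷ []

  summands₁-partition : ∀ i → Partition (summands₁ i) (layer₁ i)
  summands₁-partition = toWitness {a? = all? λ i → partition? (summands₁ i) (layer₁ i)} tt

  summands₂-partition : ∀ i → Partition (summands₂ i) (layer₂ i)
  summands₂-partition = toWitness {a? = all? λ i → partition? (summands₂ i) (layer₂ i)} tt

  summands₂'-partition : ∀ i → Partition (summands₂' i) (layer₂ i)
  summands₂'-partition = toWitness {a? = all? λ i → partition? (summands₂' i) (layer₂ i)} tt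

  summands₃-partition : ∀ i → Partition (summands₃ i) (layer₃ i)
  summands₃-partition = toWitness {a? = all? λ i → partition? (summands₃ i) (layer₃ i)} tt

  layers-exhaust : ∀ i → ⊤ ≡ layer₃ i ∪ orbit (index i (# 3))
  layers-exhaust = toWitness {a? = all? λ i → ≡-dec _≟ᵇ_ ⊤ (layer₃ i ∪ orbit (index i (# 3)))} tt

  layers-stable : ∀ i → Stable (layer₁ i) × Stable (layer₂ i) × Stable (layer₃ i)
  layers-stable = toWitness {a? = all? λ i →
    stable? (layer₁ i) ×-dec stable? (layer₂ i) ×-dec stable? (layer₃ i)} tt
    where
    stable? : ∀ s → Dec (Stable s)
    stable? s = closed? πS s ×-dec closed? πU s

  orbits-fresh : ∀ i → Disjoint (orbit (index i (# 0))) ⊥ ×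
                       Disjoint (orbit (index i (# 1))) (layer₁ i) ×
                       Disjoint (orbit (index i (# 2))) (layer₂ i) ×
                       Disjoint (orbit (index i (# 3))) (layer₃ i)
  orbits-fresh = toWitness {a? = all? λ i →
    disjoint? (orbit (index i (# 0))) ⊥ ×-dec
    disjoint? (orbit (index i (# 1))) (layer₁ i) ×-dec
    disjoint? (orbit (index i (# 2))) (layer₂ i) ×-dec
    disjoint? (orbit (index i (# 3))) (layer₃ i)} tt

  module _ (b*b⁻¹≈1 : b * b⁻¹ ≈ 1#) (≈-dec : Decidable _≈_) (1≉0 : ¬ 1# ≈ 0#)
           (inverse : ∀ x → ¬ x ≈ 0# → ∃ λ y → x * y ≈ 1#) where

    b-invertible : Invertible b
    b-invertible = b⁻¹ , trans (*-comm b⁻¹ b) b*b⁻¹≈1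

    U-weight-invertible : ∀ k → Invertible (Uweight 1# k)
    U-weight-invertible c0 = -‿invertible (*-invertible b-invertible 1-invertible)
    U-weight-invertible c1 = -‿invertible 1-invertible
    U-weight-invertible c2 = *-invertible b-invertible 1-invertible
    U-weight-invertible c3 = 1-invertible
    U-weight-invertible c4 = -‿invertible (*-invertible b-invertible 1-invertible)
    U-weight-invertible c5 = -‿invertible 1-invertible
    U-weight-invertible c6 = *-invertible b-invertible 1-invertible
    U-weight-invertible c7 = 1-invertible

    U-UnitMultiple : ∀ {k v} → UnitMultiple k v → UnitMultiple (πU k) (actU v)
    U-UnitMultiple = Monomial-UnitMultiple U-monomial πU-involutive U-weight-invertible

    nonzero-invertible : ∀ {x} → ¬ x ≈ 0# → Invertible x
    nonzero-invertible {x} x≉0 with inverse x x≉0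
    ... | y , xy≈1 = y , trans (*-comm y x) xy≈1

    -- Removing the s-part of x and projecting with ε to the factor of k leaves x_k e_k,
    -- because the orbit meets that factor only in k.
    isolate : ∀ {X s j k x} i → Disjoint (orbit j) s → IsSubmodule X → Span s ⊆ X →
              X ⊆ Span (s ∪ orbit j) → X x → k ∈ orbit j → k ∈ factor i → ¬ coord k x ≈ 0# →
              Σ M λ y → X y × UnitMultiple k y
    isolate {X} {s} {j} {k} {x} i orbit#s X-sub s⊆X X⊆ x∈X k∈orbit k∈i xₖ≉0 =
      y , y∈X , lift vanish , Invertible-resp (sym yₖ≈xₖ) (nonzero-invertible xₖ≉0)
      where
      open IsSubmodule X-sub
      y = mask (factor i) (mask (∁ s) x)
      y∈X : X y
      y∈X = ≡.subst X (actε-mask i _) (closedε i (mask-∁-∈ X-sub s⊆X x∈X))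
      yₖ≈xₖ : coord k y ≈ coord k x
      yₖ≈xₖ = reflexive (≡.trans (coord-mask-∈ _ k∈i)
                                 (coord-mask-∈ x (x∉p⇒x∈∁p (orbit#s k k∈orbit))))
      vanish : ∀ m → m ∉ ⁅ k ⁆ → coord m y ≈ 0#
      vanish m m∉ with m ∈? factor i | m ∈? s
      ... | no m∉i  | _       = reflexive (coord-mask-∉ _ m∉i)
      ... | yes _   | yes m∈s =
        coord-mask-≈0 m (factor i) _ (reflexive (coord-mask-∉ x (x∈p⇒x∉∁p m∈s)))
      ... | yes m∈i | no m∉s  =
        coord-mask-≈0 m (factor i) _
          (coord-mask-≈0 m (∁ s) x (lower (X⊆ x x∈X) m (∉-∪ m∉s m∉orbit)))
        where
        m∉orbit : m ∉ orbit j
        m∉orbit m∈orbit = m∉ (≡⇒∈⁅⁆ (orbit-meets-factor-once j m k i m∈orbit k∈orbit m∈i k∈i))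

    nonzero-orbit-coordinate : ∀ {s j x} → Span (s ∪ orbit j) x → ¬ Span s x →
                               ∃ λ k → k ∈ orbit j × ¬ coord k x ≈ 0#
    nonzero-orbit-coordinate {s} {j} {x} (lift x∈) x∉s
      with ≈-dec (coord j x) 0# | ≈-dec (coord (πU j) x) 0#
    ... | no xⱼ≉0  | _          = j , proj₁ (orbit-∋ j) , xⱼ≉0
    ... | yes _    | no xπⱼ≉0  = πU j , proj₂ (orbit-∋ j) , xπⱼ≉0
    ... | yes xⱼ≈0 | yes xπⱼ≈0 = ⊥-elim (x∉s (lift vanish))
      where
      vanish : ∀ m → m ∉ s → coord m x ≈ 0#
      vanish m m∉s with m ∈? orbit j
      ... | no m∉orbit  = x∈ m (∉-∪ m∉s m∉orbit)
      ... | yes m∈orbit = [ (λ { ≡.refl → xⱼ≈0 }) , (λ { ≡.refl → xπⱼ≈0 }) ]′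
                            (orbit-members j m j m∈orbit (proj₁ (orbit-∋ j)))

    orbit-⊆ : ∀ {X j k} → IsSubmodule X → k ∈ orbit j → (Σ M λ y → X y × UnitMultiple k y) →
              Span (orbit j) ⊆ X
    orbit-⊆ {X} {j} {k} X-sub k∈orbit (y , y∈X , y-unit) =
      Span-∪-⊆ X-sub (member-⊆ j (proj₁ (orbit-∋ j))) (member-⊆ (πU j) (proj₂ (orbit-∋ j)))
      where
      member-⊆ : ∀ m → m ∈ orbit j → Span ⁅ m ⁆ ⊆ X
      member-⊆ m m∈orbit =
        [ (λ { ≡.refl → Span-⁅⁆-⊆ X-sub y-unit y∈X })
        , (λ { ≡.refl → Span-⁅⁆-⊆ X-sub (U-UnitMultiple y-unit) (IsSubmodule.closedU X-sub y∈X) })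
        ]′ (orbit-members j m k m∈orbit k∈orbit)

    simple-orbit : ∀ {s} j → Disjoint (orbit j) s → SimpleSubquotient (Span s) (Span (s ∪ orbit j))
    simple-orbit {s} j orbit#s =
      Span-mono (p⊆p∪q _) , (e j , e-inside , e-outside) , maximal
      where
      e-inside : Span (s ∪ orbit j) (e j)
      e-inside = Span-mono (λ k∈⁅j⁆ → q⊆p∪q s (orbit j) (p⊆p∪q ⁅ πU j ⁆ k∈⁅j⁆)) _ (e-Span j)
      e-outside : ¬ Span s (e j)
      e-outside (lift e∈) =
        1≉0 (trans (sym (reflexive (coord-e-self j))) (e∈ j (orbit#s j (proj₁ (orbit-∋ j)))))
      maximal : ∀ X → IsSubmodule X → Span s ⊆ X → X ⊆ Span (s ∪ orbit j) →
                (Σ M λ x → X x × ¬ Span s x) → Span (s ∪ orbit j) ⊆ X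
      maximal X X-sub s⊆X X⊆ (x , x∈X , x∉s) with nonzero-orbit-coordinate (X⊆ x x∈X) x∉s
      ... | k , k∈orbit , xₖ≉0 = Span-∪-⊆ X-sub s⊆X (orbit-⊆ X-sub k∈orbit
              (isolate (proj₁ (factor-cover k)) orbit#s X-sub s⊆X X⊆ x∈X
                       k∈orbit (proj₂ (factor-cover k)) xₖ≉0))

    one-unit : ∀ i → UnitMultiple (index i (# 0)) (one i)
    one-unit i = ≡.subst (UnitMultiple _) (≡.sym (one-e i)) (e-UnitMultiple _)

    δone-unit : ∀ i → UnitMultiple (index i (# 2)) (δone i)
    δone-unit i = ≡.subst (UnitMultiple _) (≡.sym (δone-e i)) (e-UnitMultiple _)

    sum₁ : ∀ i → IsDirect (kSpan (one i) ∷ kSpan (actU (one i)) ∷ []) × (V₁ i ≐ Span (layer₁ i))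
    sum₁ i = direct-sum-of-Spans {ss = summands₁ i}
      (kSpan-UnitMultiple (one-unit i) ∷ kSpan-UnitMultiple (U-UnitMultiple (one-unit i)) ∷ [])
      (summands₁-partition i)

    sum₂ : ∀ i → IsDirect (ASpan (one i) ∷ ASpan (actU (one i)) ∷ []) × (V₂ i ≐ Span (layer₂ i))
    sum₂ i = direct-sum-of-Spans {ss = summands₂ i}
      (ASpan-UnitMultiple b*b⁻¹≈1 (one-unit i)
        ∷ ASpan-UnitMultiple b*b⁻¹≈1 (U-UnitMultiple (one-unit i)) ∷ [])
      (summands₂-partition i)

    sum₂' : ∀ i → IsDirect (ASpan (one i) ∷ ASpan (one (other i)) ∷ []) × (V₂' i ≐ Span (layer₂ i))
    sum₂' i = direct-sum-of-Spans {ss = summands₂' i}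
      (ASpan-UnitMultiple b*b⁻¹≈1 (one-unit i)
        ∷ ASpan-UnitMultiple b*b⁻¹≈1 (one-unit (other i)) ∷ [])
      (summands₂'-partition i)

    sum₃ : ∀ i → IsDirect (ASpan (one i) ∷ ASpan (one (other i)) ∷
                           kSpan (δone i) ∷ kSpan (actU (δone i)) ∷ []) × (V₃ i ≐ Span (layer₃ i))
    sum₃ i = direct-sum-of-Spans {ss = summands₃ i}
      (ASpan-UnitMultiple b*b⁻¹≈1 (one-unit i) ∷ ASpan-UnitMultiple b*b⁻¹≈1 (one-unit (other i))
        ∷ kSpan-UnitMultiple (δone-unit i) ∷ kSpan-UnitMultiple (U-UnitMultiple (δone-unit i)) ∷ [])
      (summands₃-partition i)

    composition-series : ∀ i → IsCompositionSeries ZeroSub (V₁ i ∷ V₂ i ∷ V₃ i ∷ Full ∷ [])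
    composition-series i =
        IsSubmodule-≐ (≐-sym Span-⊥) (Span-isSubmodule (Closed-⊥ πS , Closed-⊥ πU))
      , ( IsSubmodule-≐ V₁≐ (Span-isSubmodule stable₁)
        , IsSubmodule-≐ V₂≐ (Span-isSubmodule stable₂)
        , IsSubmodule-≐ V₃≐ (Span-isSubmodule stable₃)
        , IsSubmodule-≐ (≐-sym Span-⊤) (Span-isSubmodule (Closed-⊤ πS , Closed-⊤ πU))
        , lift tt )
      , ≐-refl
      , ≐-refl
      , ( SimpleSubquotient-≐ (≐-sym Span-⊥) V₁≐ (simple-orbit _ fresh₁)
        , SimpleSubquotient-≐ V₁≐ V₂≐ (simple-orbit _ fresh₂)
        , SimpleSubquotient-≐ V₂≐ V₃≐ (simple-orbit _ fresh₃)
        , SimpleSubquotient-≐ V₃≐ Full≐ (simple-orbit _ fresh₄)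
        , lift tt )
      where
      V₁≐ = proj₂ (sum₁ i)
      V₂≐ = proj₂ (sum₂ i)
      V₃≐ = proj₂ (sum₃ i)
      Full≐ : Full ≐ Span (layer₃ i ∪ orbit (index i (# 3)))
      Full≐ = ≐-trans (≐-sym Span-⊤) (Span-≡ (layers-exhaust i))
      stable₁ = proj₁ (layers-stable i)
      stable₂ = proj₁ (proj₂ (layers-stable i))
      stable₃ = proj₂ (proj₂ (layers-stable i))
      fresh₁ = proj₁ (orbits-fresh i)
      fresh₂ = proj₁ (proj₂ (orbits-fresh i))
      fresh₃ = proj₁ (proj₂ (proj₂ (orbits-fresh i)))
      fresh₄ = proj₂ (proj₂ (proj₂ (orbits-fresh i)))

    theorem10Claim : ∀ i → Theorem10Claim i
    theorem10Claim i =
        proj₁ (sum₁ i) , proj₁ (sum₂ i) , proj₁ (sum₂' i) , proj₁ (sum₃ i)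
      , ≐-trans (proj₂ (sum₂ i)) (≐-sym (proj₂ (sum₂' i)))
      , composition-series i

mainTheorem10 : ∀ {c ℓ} (K : CommutativeRing c ℓ) (p : ℕ) → Prime p → p ≢ 2 →
                  IsAlgClosureOfFp K p →
                  (b b⁻¹ : CommutativeRing.Carrier K) →
                  CommutativeRing._≈_ K (CommutativeRing._*_ K b b⁻¹) (CommutativeRing.1# K) →
                  (i : Fin 2) → Mb.Theorem10Claim K b b⁻¹ i
mainTheorem10 K _ _ _ closure b b⁻¹ b*b⁻¹≈1 =
  theorem10Claim K b b⁻¹ b*b⁻¹≈1 decEq nontrivial inverse
  where open IsAlgClosureOfFp closure
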